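{- The coefficient of $q^N$ in $H_{6,3,6}(q)$ is nonnegative for every integer $N \ge 67$.
   Context: $(a;q)_n := (1-a)(1-aq)\cdots(1-aq^{n-1})$. For positive integers $L,s,k$, $H_{L,s,k}(q) := \frac{q^s(1-q^k)}{(q^s;q)_{L+1}} - \left(\frac{1}{(q^{s+1};q)_L}-1\right)$. -}

module Defs where

open import Data.Nat as ℕ using (ℕ; zero; suc; _∸_)
open import Data.Nat.Divisibility using (_∣?_)
open import Data.Integer using (ℤ; +_; _+_; _-_; _*_; 0ℤ; 1ℤ)
open import Relation.Nullary using (yes; no)

-- Formal power series in q with integer coefficients: n ↦ coefficient of q^n.
PS : Set
PS = ℕ → ℤ

one : PS
one zero    = 1ℤ
one (suc _) = 0ℤ

qpow : ℕ → PS
qpow m n with m ℕ.≟ n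
... | yes _ = 1ℤ
... | no  _ = 0ℤ

infixl 6 _⊕_ _⊖_
infixl 7 _⊛_

_⊕_ : PS → PS → PS
(f ⊕ g) n = f n + g n

_⊖_ : PS → PS → PS
(f ⊖ g) n = f n - g n

sumUpTo : ℕ → (ℕ → ℤ) → ℤ
sumUpTo zero    h = h 0
sumUpTo (suc n) h = sumUpTo n h + h (suc n)

_⊛_ : PS → PS → PS
(f ⊛ g) n = sumUpTo n (λ i → f i * g (n ∸ i))

-- 1/(1 - q^(suc j)) = Σ_{m ≥ 0} q^{(suc j) m}, the multiplicative inverse of 1 - q^(suc j)
geomInv : ℕ → PS
geomInv j n with suc j ∣? n
... | yes _ = 1ℤ
... | no  _ = 0ℤ

-- 1/(q^s;q)_L = Π_{i<L} 1/(1 - q^(s+i)), for s ≥ 1 written s = suc t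
invPoch : (t : ℕ) → (L : ℕ) → PS
invPoch t zero    = one
invPoch t (suc L) = invPoch t L ⊛ geomInv (t ℕ.+ L)

-- H_{L,s,k}(q) = q^s (1-q^k)/(q^s;q)_{L+1} - (1/(q^{s+1};q)_L - 1),
-- for positive s = suc t (and positive L, k).
H : (L t k : ℕ) → PS
H L t k = (qpow (suc t) ⊛ (one ⊖ qpow k)) ⊛ invPoch t (suc L)
          ⊖ (invPoch (suc t) L ⊖ one)

-- Write N = 9 + M and let c_L(M) be the coefficient of q^N in H_{L,3,6}. Then
-- c_L(M) = p_{L+1}(M + 6) − p_{L+1}(M) − r_L(M + 9), where p_L and r_L are the
-- coefficients of 1/(q^3;q)_L and 1/(q^4;q)_L. Both families grow by the factor
-- 1/(1 − q^{L+4}) when L is raised, hence c_{L+1}(L + 4 + M) = c_L(L + 4 + M) + c_{L+1}(M).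
-- Since 1/(1 − q^3) is 3-periodic and 3 ∣ 6, c_0 = 0; so c_1 is 4-periodic with
-- period values 0, 1, 1, −1, and c_2(15 + M) − c_2(M) is a sum of three
-- consecutive values of c_1, hence nonnegative. From then on each c_{L+1} is
-- nonnegative as soon as c_L is and c_{L+1} is nonnegative on one window of
-- length L + 4; these finitely many windows are checked by evaluation.
-- The argument gives nonnegativity already for N ≥ 21.
{-# OPTIONS --safe #-}
module Submission where

open import Defs
open import Data.Nat using (ℕ; _≤_)
open import Data.Integer using (+_) renaming (_≤_ to _≤ℤ_)

open import Data.Nat using (zero; suc; _+_; _∸_; _<_; _≟_; _≤?_; z≤n; s≤s; NonZero; >-nonZero⁻¹)
open import Data.Nat.Properties
  using ( ≤-refl; ≤-trans; ≤-reflexive; ≤-pred; m≤n⇒m≤1+n; <⇒≢; ≤∧≢⇒<; ≰⇒>; ≤ᵇ⇒≤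
        ; m≤m+n; m≤n+m; +-comm; +-assoc; +-suc; +-identityʳ; +-monoʳ-≤; +-monoˡ-≤
        ; m∸n≤m; m<n⇒0<n∸m; ∸-monoˡ-≤; ∸-monoʳ-<; +-∸-comm; [m+n]∸[m+o]≡n∸o
        ; m+[n∸m]≡n; m∸n+n≡m; m+n∸n≡m; n∸n≡0; m<n+o⇒m∸n<o; allUpTo?)
open import Data.Nat.Divisibility using (_∣_; divides; _∣?_; _∣0; ∣-refl; ∣m+n∣m⇒∣n; ∣m∣n⇒∣m+n; >⇒∤)
open import Data.Nat.Induction using (<-rec)
import Data.Integer as ℤ
open import Data.Integer using (ℤ; 0ℤ; 1ℤ)
import Data.Integer.Properties as ℤₚ
open import Data.Integer.Tactic.RingSolver using (solve-∀)
open import Function using (_∘_)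
open import Relation.Binary.PropositionalEquality
open import Relation.Nullary using (yes; no; contradiction)
open import Relation.Nullary.Decidable using (True; toWitness)

open ≡-Reasoning

sumUpTo-cong : ∀ n {h g : ℕ → ℤ} → (∀ {i} → i ≤ n → h i ≡ g i) → sumUpTo n h ≡ sumUpTo n g
sumUpTo-cong zero    h≗g = h≗g z≤n
sumUpTo-cong (suc n) h≗g = cong₂ ℤ._+_ (sumUpTo-cong n (h≗g ∘ m≤n⇒m≤1+n)) (h≗g ≤-refl)

sumUpTo-zero : ∀ n {h : ℕ → ℤ} → (∀ {i} → i ≤ n → h i ≡ 0ℤ) → sumUpTo n h ≡ 0ℤ
sumUpTo-zero zero    h≗0 = h≗0 z≤n
sumUpTo-zero (suc n) h≗0 = cong₂ ℤ._+_ (sumUpTo-zero n (h≗0 ∘ m≤n⇒m≤1+n)) (h≗0 ≤-refl)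

sumUpTo-single : ∀ {n a} {h : ℕ → ℤ} → a ≤ n → (∀ {i} → i ≤ n → i ≢ a → h i ≡ 0ℤ) →
                 sumUpTo n h ≡ h a
sumUpTo-single {zero} z≤n _ = refl
sumUpTo-single {suc n} {a} {h} a≤1+n h≗0 with a ≟ suc n
... | yes refl = begin
  sumUpTo n h ℤ.+ h a  ≡⟨ cong (ℤ._+ h a) (sumUpTo-zero n (λ i≤n → h≗0 (m≤n⇒m≤1+n i≤n) (<⇒≢ (s≤s i≤n)))) ⟩
  0ℤ ℤ.+ h a           ≡⟨ ℤₚ.+-identityˡ (h a) ⟩
  h a                  ∎
... | no a≢1+n = begin
  sumUpTo n h ℤ.+ h (suc n)  ≡⟨ cong₂ ℤ._+_ (sumUpTo-single a≤n (h≗0 ∘ m≤n⇒m≤1+n)) (h≗0 ≤-refl (a≢1+n ∘ sym)) ⟩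
  h a ℤ.+ 0ℤ                 ≡⟨ ℤₚ.+-identityʳ (h a) ⟩
  h a                        ∎
  where
  a≤n : a ≤ n
  a≤n = ≤-pred (≤∧≢⇒< a≤1+n a≢1+n)

sumUpTo-split : ∀ n k (h : ℕ → ℤ) →
                sumUpTo (n + suc k) h ≡ sumUpTo n h ℤ.+ sumUpTo k (λ r → h (suc (n + r)))
sumUpTo-split n zero    h rewrite +-suc n 0 | +-identityʳ n = refl
sumUpTo-split n (suc k) h rewrite +-suc n (suc k) | sumUpTo-split n k h =
  ℤₚ.+-assoc (sumUpTo n h) (sumUpTo k (λ r → h (suc (n + r)))) (h (suc (n + suc k)))

sumUpTo-vanishing-tail : ∀ n k (h : ℕ → ℤ) → (∀ {i} → n < i → h i ≡ 0ℤ) →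
                         sumUpTo (n + k) h ≡ sumUpTo n h
sumUpTo-vanishing-tail n zero    h h≗0 rewrite +-identityʳ n = refl
sumUpTo-vanishing-tail n (suc k) h h≗0
  rewrite +-suc n k | sumUpTo-vanishing-tail n k h h≗0 | h≗0 (s≤s (m≤m+n n k)) =
  ℤₚ.+-identityʳ (sumUpTo n h)

⊛-single : ∀ {f : PS} g {a n} → a ≤ n → (∀ {i} → i ≢ a → f i ≡ 0ℤ) →
           (f ⊛ g) n ≡ f a ℤ.* g (n ∸ a)
⊛-single {f} g {n = n} a≤n f≗0 =
  sumUpTo-single a≤n (λ {i} _ i≢a → trans (cong (ℤ._* g (n ∸ i)) (f≗0 i≢a)) (ℤₚ.*-zeroˡ (g (n ∸ i))))

one-⊛ : ∀ f n → (one ⊛ f) n ≡ f n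
one-⊛ f n = trans (⊛-single f z≤n one-off-0) (ℤₚ.*-identityˡ (f n))
  where
  one-off-0 : ∀ {i} → i ≢ 0 → one i ≡ 0ℤ
  one-off-0 {zero}  0≢0 = contradiction refl 0≢0
  one-off-0 {suc i} _   = refl

qpow-≢ : ∀ {a i} → i ≢ a → qpow a i ≡ 0ℤ
qpow-≢ {a} {i} i≢a with a ≟ i
... | yes a≡i = contradiction (sym a≡i) i≢a
... | no  _   = refl

qpow-⊛ : ∀ a f {n} → a ≤ n → (qpow a ⊛ f) n ≡ f (n ∸ a)
qpow-⊛ a f {n} a≤n = trans (⊛-single f a≤n qpow-≢) (trans (cong (ℤ._* f (n ∸ a)) qpow-diag) (ℤₚ.*-identityˡ _))
  where
  qpow-diag : qpow a a ≡ 1ℤ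
  qpow-diag with a ≟ a
  ... | yes _   = refl
  ... | no  a≢a = contradiction refl a≢a

geomInv-periodic : ∀ j {k} n → suc j ∣ k → geomInv j (k + n) ≡ geomInv j n
geomInv-periodic j {k} n j+1∣k with suc j ∣? (k + n) | suc j ∣? n
... | yes _       | yes _       = refl
... | no  _       | no  _       = refl
... | yes j+1∣k+n | no  j+1∤n   = contradiction (∣m+n∣m⇒∣n j+1∣k+n j+1∣k) j+1∤n
... | no  j+1∤k+n | yes j+1∣n   = contradiction (∣m∣n⇒∣m+n j+1∣k j+1∣n) j+1∤k+n

geomInv-0 : ∀ j → geomInv j 0 ≡ 1ℤ
geomInv-0 j with suc j ∣? 0
... | yes _    = refl
... | no  j+1∤0 = contradiction (suc j ∣0) j+1∤0

geomInv-below : ∀ j {n} → 0 < n → n ≤ j → geomInv j n ≡ 0ℤ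
geomInv-below j {suc n} _ n<j+1 with suc j ∣? suc n
... | yes j+1∣1+n = contradiction j+1∣1+n (>⇒∤ (s≤s n<j+1))
... | no  _     = refl

⊛-geomInv-low : ∀ f j {n} → n ≤ j → (f ⊛ geomInv j) n ≡ f n
⊛-geomInv-low f j {n} n≤j = begin
  (f ⊛ geomInv j) n          ≡⟨ sumUpTo-single ≤-refl off-diagonal ⟩
  f n ℤ.* geomInv j (n ∸ n)  ≡⟨ cong (λ x → f n ℤ.* geomInv j x) (n∸n≡0 n) ⟩
  f n ℤ.* geomInv j 0        ≡⟨ cong (f n ℤ.*_) (geomInv-0 j) ⟩
  f n ℤ.* 1ℤ                 ≡⟨ ℤₚ.*-identityʳ (f n) ⟩
  f n                        ∎
  where
  off-diagonal : ∀ {i} → i ≤ n → i ≢ n → f i ℤ.* geomInv j (n ∸ i) ≡ 0ℤ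
  off-diagonal {i} i≤n i≢n = trans
    (cong (f i ℤ.*_) (geomInv-below j (m<n⇒0<n∸m (≤∧≢⇒< i≤n i≢n)) (≤-trans (m∸n≤m n i) n≤j)))
    (ℤₚ.*-zeroʳ (f i))

⊛-geomInv-step : ∀ f j n → (f ⊛ geomInv j) (n + suc j) ≡ f (n + suc j) ℤ.+ (f ⊛ geomInv j) n
⊛-geomInv-step f j n = begin
  (f ⊛ geomInv j) (n + suc j)
    ≡⟨ sumUpTo-split n j _ ⟩
  sumUpTo n (λ i → f i ℤ.* geomInv j (n + suc j ∸ i))
    ℤ.+ sumUpTo j (λ r → f (suc (n + r)) ℤ.* geomInv j (n + suc j ∸ suc (n + r)))
    ≡⟨ cong₂ ℤ._+_ (sumUpTo-cong n shifted) (sumUpTo-single ≤-refl off-top) ⟩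
  (f ⊛ geomInv j) n ℤ.+ f (suc (n + j)) ℤ.* geomInv j (n + suc j ∸ suc (n + j))
    ≡⟨ cong (λ x → (f ⊛ geomInv j) n ℤ.+ x) top ⟩
  (f ⊛ geomInv j) n ℤ.+ f (n + suc j)
    ≡⟨ ℤₚ.+-comm ((f ⊛ geomInv j) n) (f (n + suc j)) ⟩
  f (n + suc j) ℤ.+ (f ⊛ geomInv j) n
    ∎
  where
  gap : ∀ r → n + suc j ∸ suc (n + r) ≡ j ∸ r
  gap r rewrite +-suc n j = [m+n]∸[m+o]≡n∸o n j r

  shifted : ∀ {i} → i ≤ n → f i ℤ.* geomInv j (n + suc j ∸ i) ≡ f i ℤ.* geomInv j (n ∸ i)
  shifted {i} i≤n = cong (f i ℤ.*_) (begin
    geomInv j (n + suc j ∸ i)    ≡⟨ cong (geomInv j) (trans (+-∸-comm (suc j) i≤n) (+-comm (n ∸ i) (suc j))) ⟩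
    geomInv j (suc j + (n ∸ i))  ≡⟨ geomInv-periodic j (n ∸ i) ∣-refl ⟩
    geomInv j (n ∸ i)            ∎)

  off-top : ∀ {r} → r ≤ j → r ≢ j → f (suc (n + r)) ℤ.* geomInv j (n + suc j ∸ suc (n + r)) ≡ 0ℤ
  off-top {r} r≤j r≢j = begin
    f (suc (n + r)) ℤ.* geomInv j (n + suc j ∸ suc (n + r))  ≡⟨ cong (λ x → f (suc (n + r)) ℤ.* geomInv j x) (gap r) ⟩
    f (suc (n + r)) ℤ.* geomInv j (j ∸ r)                    ≡⟨ cong (f (suc (n + r)) ℤ.*_) (geomInv-below j (m<n⇒0<n∸m (≤∧≢⇒< r≤j r≢j)) (m∸n≤m j r)) ⟩
    f (suc (n + r)) ℤ.* 0ℤ                                   ≡⟨ ℤₚ.*-zeroʳ (f (suc (n + r))) ⟩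
    0ℤ                                                       ∎

  top : f (suc (n + j)) ℤ.* geomInv j (n + suc j ∸ suc (n + j)) ≡ f (n + suc j)
  top = begin
    f (suc (n + j)) ℤ.* geomInv j (n + suc j ∸ suc (n + j))  ≡⟨ cong (λ x → f (suc (n + j)) ℤ.* geomInv j x) (trans (gap j) (n∸n≡0 j)) ⟩
    f (suc (n + j)) ℤ.* geomInv j 0                          ≡⟨ cong (f (suc (n + j)) ℤ.*_) (geomInv-0 j) ⟩
    f (suc (n + j)) ℤ.* 1ℤ                                   ≡⟨ ℤₚ.*-identityʳ (f (suc (n + j))) ⟩
    f (suc (n + j))                                          ≡⟨ cong f (sym (+-suc n j)) ⟩
    f (n + suc j)                                            ∎

invPoch-step : ∀ t L m →
               invPoch t (suc L) (m + suc (t + L)) ≡ invPoch t L (m + suc (t + L)) ℤ.+ invPoch t (suc L) m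
invPoch-step t L = ⊛-geomInv-step (invPoch t L) (t + L)

invPoch-step-∸ : ∀ t L {n} → suc (t + L) ≤ n →
                 invPoch t (suc L) n ≡ invPoch t L n ℤ.+ invPoch t (suc L) (n ∸ suc (t + L))
invPoch-step-∸ t L {n} p≤n =
  subst (λ x → invPoch t (suc L) x ≡ invPoch t L x ℤ.+ invPoch t (suc L) (n ∸ suc (t + L)))
        (m∸n+n≡m p≤n) (invPoch-step t L (n ∸ suc (t + L)))

invPoch-one : ∀ t n → invPoch t 1 n ≡ geomInv t n
invPoch-one t n rewrite +-identityʳ t = one-⊛ (geomInv t) n

-- invPoch-step read as a program: coefficients by recursion instead of nested
-- Cauchy products, which are far too slow to evaluate. The fuel bounds n + L.
invPochᶠ : (fuel t L n : ℕ) → ℤ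
invPochᶠ _          t zero    n = one n
invPochᶠ zero       t (suc L) n = 0ℤ
invPochᶠ (suc fuel) t (suc L) n with suc (t + L) ≤? n
... | yes _ = invPochᶠ fuel t L n ℤ.+ invPochᶠ fuel t (suc L) (n ∸ suc (t + L))
... | no  _ = invPochᶠ fuel t L n

invPochᶠ-correct : ∀ fuel t L n → n + L ≤ fuel → invPochᶠ fuel t L n ≡ invPoch t L n
invPochᶠ-correct _          t zero    n _ = refl
invPochᶠ-correct zero       t (suc L) n bound = contradiction (≤-trans (m≤n+m (suc L) n) bound) λ ()
invPochᶠ-correct (suc fuel) t (suc L) n bound
  with suc (t + L) ≤? n | ≤-pred (subst (_≤ suc fuel) (+-suc n L) bound)
... | yes p≤n | lower = begin
  invPochᶠ fuel t L n ℤ.+ invPochᶠ fuel t (suc L) (n ∸ suc (t + L))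
    ≡⟨ cong₂ ℤ._+_ (invPochᶠ-correct fuel t L n lower) (invPochᶠ-correct fuel t (suc L) _ earlier) ⟩
  invPoch t L n ℤ.+ invPoch t (suc L) (n ∸ suc (t + L))
    ≡⟨ sym (invPoch-step-∸ t L p≤n) ⟩
  invPoch t (suc L) n
    ∎
  where
  earlier : n ∸ suc (t + L) + suc L ≤ fuel
  earlier = ≤-pred (≤-trans (+-monoˡ-≤ (suc L) (∸-monoʳ-< (s≤s z≤n) p≤n)) bound)
... | no  p≰n | lower =
  trans (invPochᶠ-correct fuel t L n lower) (sym (⊛-geomInv-low (invPoch t L) (t + L) (≤-pred (≰⇒> p≰n))))

invPochᶜ : (t L n : ℕ) → ℤ
invPochᶜ t L n = invPochᶠ (n + L) t L n

invPochᶜ≡invPoch : ∀ t L n → invPochᶜ t L n ≡ invPoch t L n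
invPochᶜ≡invPoch t L n = invPochᶠ-correct (n + L) t L n ≤-refl

-- The coefficient of q^(suc t + k + M) in H L t k (H-coeff checks this for t = 2, k = 6).
coeffH : (t k L M : ℕ) → ℤ
coeffH t k L M = invPoch t (suc L) (k + M) ℤ.- invPoch t (suc L) M ℤ.- invPoch (suc t) L (suc t + k + M)

coeffH-step : ∀ t k L m →
              coeffH t k (suc L) (2 + t + L + m) ≡ coeffH t k L (2 + t + L + m) ℤ.+ coeffH t k (suc L) m
coeffH-step t k L m = begin
  coeffH t k (suc L) (p + m)
    ≡⟨ cong₂ ℤ._-_ (cong₂ ℤ._-_ (shifted P P′ P-step k) (shifted P P′ P-step 0)) (shifted Q Q′ Q-step (suc t + k)) ⟩
  (P (k + (p + m)) ℤ.+ P′ (k + m)) ℤ.- (P (p + m) ℤ.+ P′ m) ℤ.- (Q (suc t + k + (p + m)) ℤ.+ Q′ (suc t + k + m))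
    ≡⟨ regroup (P (k + (p + m))) (P (p + m)) (Q (suc t + k + (p + m))) (P′ (k + m)) (P′ m) (Q′ (suc t + k + m)) ⟩
  coeffH t k L (p + m) ℤ.+ coeffH t k (suc L) m
    ∎
  where
  p : ℕ
  p = 2 + t + L
  P P′ Q Q′ : ℕ → ℤ
  P  = invPoch t (suc L)
  P′ = invPoch t (2 + L)
  Q  = invPoch (suc t) L
  Q′ = invPoch (suc t) (suc L)

  P-step : ∀ n → P′ (n + p) ≡ P (n + p) ℤ.+ P′ n
  P-step n = subst (λ x → P′ (n + x) ≡ P (n + x) ℤ.+ P′ n) (cong suc (+-suc t L)) (invPoch-step t (suc L) n)

  Q-step : ∀ n → Q′ (n + p) ≡ Q (n + p) ℤ.+ Q′ n
  Q-step = invPoch-step (suc t) L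

  shifted : ∀ (F F′ : ℕ → ℤ) → (∀ n → F′ (n + p) ≡ F (n + p) ℤ.+ F′ n) →
            ∀ a → F′ (a + (p + m)) ≡ F (a + (p + m)) ℤ.+ F′ (a + m)
  shifted F F′ step a = subst (λ x → F′ x ≡ F x ℤ.+ F′ (a + m))
                              (trans (+-assoc a m p) (cong (λ x → a + x) (+-comm m p))) (step (a + m))

  regroup : ∀ a b c d e f → (a ℤ.+ d) ℤ.- (b ℤ.+ e) ℤ.- (c ℤ.+ f) ≡ (a ℤ.- b ℤ.- c) ℤ.+ (d ℤ.- e ℤ.- f)
  regroup = solve-∀

coeffH-base : ∀ t {k} → suc t ∣ k → ∀ M → coeffH t k 0 M ≡ 0ℤ
coeffH-base t {k} t+1∣k M = begin
  invPoch t 1 (k + M) ℤ.- invPoch t 1 M ℤ.- 0ℤ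
    ≡⟨ cong (λ x → x ℤ.- invPoch t 1 M ℤ.- 0ℤ) periodic ⟩
  invPoch t 1 M ℤ.- invPoch t 1 M ℤ.- 0ℤ
    ≡⟨ ℤₚ.+-identityʳ (invPoch t 1 M ℤ.- invPoch t 1 M) ⟩
  invPoch t 1 M ℤ.- invPoch t 1 M
    ≡⟨ ℤₚ.+-inverseʳ (invPoch t 1 M) ⟩
  0ℤ
    ∎
  where
  periodic : invPoch t 1 (k + M) ≡ invPoch t 1 M
  periodic = begin
    invPoch t 1 (k + M)  ≡⟨ invPoch-one t (k + M) ⟩
    geomInv t (k + M)    ≡⟨ geomInv-periodic t M t+1∣k ⟩
    geomInv t M          ≡⟨ invPoch-one t M ⟨
    invPoch t 1 M        ∎

H-coeff : ∀ L M → H L 2 6 (9 + M) ≡ coeffH 2 6 L M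
H-coeff L M = cong₂ ℤ._-_ numerator (ℤₚ.+-identityʳ (invPoch 3 L (9 + M)))
  where
  P e : ℕ → ℤ
  P = invPoch 2 (suc L)
  e = qpow 3 ⊛ (one ⊖ qpow 6)

  e-vanishes : ∀ r → e (10 + r) ≡ 0ℤ
  e-vanishes r = begin
    e (10 + r)                         ≡⟨ qpow-⊛ 3 (one ⊖ qpow 6) {10 + r} (s≤s (s≤s (s≤s z≤n))) ⟩
    0ℤ ℤ.- qpow 6 (7 + r)              ≡⟨ cong (λ x → 0ℤ ℤ.- x) (qpow-≢ {6} {7 + r} λ ()) ⟩
    0ℤ                                 ∎

  tail-vanishes : ∀ {i} → 9 < i → e i ℤ.* P (9 + M ∸ i) ≡ 0ℤ
  tail-vanishes {i} 9<i = begin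
    e i ℤ.* P (9 + M ∸ i)                 ≡⟨ cong (λ j → e j ℤ.* P (9 + M ∸ i)) (m+[n∸m]≡n 9<i) ⟨
    e (10 + (i ∸ 10)) ℤ.* P (9 + M ∸ i)   ≡⟨ cong (ℤ._* P (9 + M ∸ i)) (e-vanishes (i ∸ 10)) ⟩
    0ℤ ℤ.* P (9 + M ∸ i)                  ≡⟨ ℤₚ.*-zeroˡ (P (9 + M ∸ i)) ⟩
    0ℤ                                    ∎

  -- e = q^3 − q^9: its coefficients in degrees 0, …, 9 appear by evaluation in numerator.
  ten-terms : ∀ y₀ y₁ y₂ y₃ y₄ y₅ y₆ y₇ y₈ y₉ →
    0ℤ ℤ.* y₀ ℤ.+ 0ℤ ℤ.* y₁ ℤ.+ 0ℤ ℤ.* y₂ ℤ.+ 1ℤ ℤ.* y₃ ℤ.+ 0ℤ ℤ.* y₄ ℤ.+ 0ℤ ℤ.* y₅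
      ℤ.+ 0ℤ ℤ.* y₆ ℤ.+ 0ℤ ℤ.* y₇ ℤ.+ 0ℤ ℤ.* y₈ ℤ.+ (ℤ.- 1ℤ) ℤ.* y₉ ≡ y₃ ℤ.- y₉
  ten-terms = solve-∀

  numerator : (e ⊛ P) (9 + M) ≡ P (6 + M) ℤ.- P M
  numerator = begin
    (e ⊛ P) (9 + M)
      ≡⟨ sumUpTo-vanishing-tail 9 M _ tail-vanishes ⟩
    sumUpTo 9 (λ i → e i ℤ.* P (9 + M ∸ i))
      ≡⟨ ten-terms (P (9 + M)) (P (8 + M)) (P (7 + M)) (P (6 + M)) (P (5 + M))
                   (P (4 + M)) (P (3 + M)) (P (2 + M)) (P (1 + M)) (P M) ⟩
    P (6 + M) ℤ.- P M
      ∎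

nonneg-by-recurrence : ∀ (f g : ℕ → ℤ) p b .{{_ : NonZero p}} →
                       (∀ m → g (p + m) ≡ f m ℤ.+ g m) →
                       (∀ m → b ≤ m → 0ℤ ≤ℤ f m) →
                       (∀ {i} → i < p → 0ℤ ≤ℤ g (b + i)) →
                       ∀ m → b ≤ m → 0ℤ ≤ℤ g m
nonneg-by-recurrence f g p b recurrence f≥0 window = <-rec (λ m → b ≤ m → 0ℤ ≤ℤ g m) step
  where
  step : ∀ m → (∀ {m′} → m′ < m → b ≤ m′ → 0ℤ ≤ℤ g m′) → b ≤ m → 0ℤ ≤ℤ g m
  step m ih b≤m with b + p ≤? m
  ... | no  b+p≰m = subst (λ x → 0ℤ ≤ℤ g x) (m+[n∸m]≡n b≤m) (window (m<n+o⇒m∸n<o m b (≰⇒> b+p≰m)))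
  ... | yes b+p≤m = subst (λ x → 0ℤ ≤ℤ g x) (m+[n∸m]≡n p≤m)
                      (subst (0ℤ ≤ℤ_) (sym (recurrence (m ∸ p)))
                        (ℤₚ.+-mono-≤ (f≥0 (m ∸ p) b≤m∸p) (ih (∸-monoʳ-< (>-nonZero⁻¹ p) p≤m) b≤m∸p)))
    where
    p≤m : p ≤ m
    p≤m = ≤-trans (m≤n+m p b) b+p≤m
    b≤m∸p : b ≤ m ∸ p
    b≤m∸p = ≤-trans (≤-reflexive (sym (m+n∸n≡m b p))) (∸-monoˡ-≤ p b+p≤m)

nonneg-window : ∀ (g gᶜ : ℕ → ℤ) → (∀ m → gᶜ m ≡ g m) → ∀ b n →
                True (allUpTo? (λ i → 0ℤ ℤ.≤? gᶜ (b + i)) n) →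
                ∀ {i} → i < n → 0ℤ ≤ℤ g (b + i)
nonneg-window g gᶜ gᶜ≗g b n checked {i} i<n = subst (0ℤ ≤ℤ_) (gᶜ≗g (b + i)) (toWitness checked i<n)

coeffH-nonneg-step : ∀ t k L b b′ → b ≤ b′ + (2 + t + L) →
                     (∀ M → b ≤ M → 0ℤ ≤ℤ coeffH t k L M) →
                     (∀ {i} → i < 2 + t + L → 0ℤ ≤ℤ coeffH t k (suc L) (b′ + i)) →
                     ∀ M → b′ ≤ M → 0ℤ ≤ℤ coeffH t k (suc L) M
coeffH-nonneg-step t k L b b′ b≤b′+p cL≥0 =
  nonneg-by-recurrence (λ m → coeffH t k L (p + m)) (coeffH t k (suc L)) p b′ (coeffH-step t k L)
    (λ m b′≤m → cL≥0 (p + m) (≤-trans b≤b′+p (≤-trans (≤-reflexive (+-comm b′ p)) (+-monoʳ-≤ p b′≤m))))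
  where
  p : ℕ
  p = 2 + t + L

coeffHᶜ : (t k L M : ℕ) → ℤ
coeffHᶜ t k L M = invPochᶜ t (suc L) (k + M) ℤ.- invPochᶜ t (suc L) M ℤ.- invPochᶜ (suc t) L (suc t + k + M)

coeffHᶜ≡coeffH : ∀ t k L M → coeffHᶜ t k L M ≡ coeffH t k L M
coeffHᶜ≡coeffH t k L M =
  cong₂ ℤ._-_ (cong₂ ℤ._-_ (invPochᶜ≡invPoch t (suc L) (k + M)) (invPochᶜ≡invPoch t (suc L) M))
              (invPochᶜ≡invPoch (suc t) L (suc t + k + M))

c : (L M : ℕ) → ℤ
c = coeffH 2 6

c-window : ∀ L b n → True (allUpTo? (λ i → 0ℤ ℤ.≤? coeffHᶜ 2 6 L (b + i)) n) →
           ∀ {i} → i < n → 0ℤ ≤ℤ c L (b + i)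
c-window L = nonneg-window (c L) (coeffHᶜ 2 6 L) (coeffHᶜ≡coeffH 2 6 L)

c₁-periodic : ∀ m → c 1 (4 + m) ≡ c 1 m
c₁-periodic m = begin
  c 1 (4 + m)              ≡⟨ coeffH-step 2 6 0 m ⟩
  c 0 (4 + m) ℤ.+ c 1 m    ≡⟨ cong (ℤ._+ c 1 m) (coeffH-base 2 (divides 2 refl) (4 + m)) ⟩
  0ℤ ℤ.+ c 1 m             ≡⟨ ℤₚ.+-identityˡ (c 1 m) ⟩
  c 1 m                    ∎

c₁-triple : ℕ → ℤ
c₁-triple m = c 1 (15 + m) ℤ.+ c 1 (10 + m) ℤ.+ c 1 (5 + m)

c₁-triple-nonneg : ∀ m → 0ℤ ≤ℤ c₁-triple m
c₁-triple-nonneg m =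
  nonneg-by-recurrence (λ _ → 0ℤ) c₁-triple 4 0 periodic (λ _ _ → ℤₚ.≤-refl)
    (nonneg-window c₁-triple c₁-triple (λ _ → refl) 0 4 _) m z≤n
  where
  periodic : ∀ m → c₁-triple (4 + m) ≡ 0ℤ ℤ.+ c₁-triple m
  periodic m = trans (cong₂ ℤ._+_ (cong₂ ℤ._+_ (c₁-periodic (15 + m)) (c₁-periodic (10 + m))) (c₁-periodic (5 + m)))
                     (sym (ℤₚ.+-identityˡ (c₁-triple m)))

c₂-recurrence : ∀ m → c 2 (15 + m) ≡ c₁-triple m ℤ.+ c 2 m
c₂-recurrence m = begin
  c 2 (15 + m)                                                  ≡⟨ step (10 + m) ⟩
  c 1 (15 + m) ℤ.+ c 2 (10 + m)                                 ≡⟨ cong (λ x → c 1 (15 + m) ℤ.+ x) (step (5 + m)) ⟩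
  c 1 (15 + m) ℤ.+ (c 1 (10 + m) ℤ.+ c 2 (5 + m))               ≡⟨ cong (λ x → c 1 (15 + m) ℤ.+ (c 1 (10 + m) ℤ.+ x)) (step m) ⟩
  c 1 (15 + m) ℤ.+ (c 1 (10 + m) ℤ.+ (c 1 (5 + m) ℤ.+ c 2 m))   ≡⟨ reassoc (c 1 (15 + m)) (c 1 (10 + m)) (c 1 (5 + m)) (c 2 m) ⟩
  c₁-triple m ℤ.+ c 2 m                                         ∎
  where
  step : ∀ n → c 2 (5 + n) ≡ c 1 (5 + n) ℤ.+ c 2 n
  step = coeffH-step 2 6 1
  reassoc : ∀ a b d e → a ℤ.+ (b ℤ.+ (d ℤ.+ e)) ≡ a ℤ.+ b ℤ.+ d ℤ.+ e
  reassoc = solve-∀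

c₂-nonneg : ∀ M → 1 ≤ M → 0ℤ ≤ℤ c 2 M
c₂-nonneg = nonneg-by-recurrence c₁-triple (c 2) 15 1 c₂-recurrence (λ m _ → c₁-triple-nonneg m) (c-window 2 1 15 _)

c₃-nonneg : ∀ M → 2 ≤ M → 0ℤ ≤ℤ c 3 M
c₃-nonneg = coeffH-nonneg-step 2 6 2 1 2 (≤ᵇ⇒≤ 1 8 _) c₂-nonneg (c-window 3 2 6 _)

c₄-nonneg : ∀ M → 4 ≤ M → 0ℤ ≤ℤ c 4 M
c₄-nonneg = coeffH-nonneg-step 2 6 3 2 4 (≤ᵇ⇒≤ 2 11 _) c₃-nonneg (c-window 4 4 7 _)

c₅-nonneg : ∀ M → 12 ≤ M → 0ℤ ≤ℤ c 5 M
c₅-nonneg = coeffH-nonneg-step 2 6 4 4 12 (≤ᵇ⇒≤ 4 20 _) c₄-nonneg (c-window 5 12 8 _)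

c₆-nonneg : ∀ M → 12 ≤ M → 0ℤ ≤ℤ c 6 M
c₆-nonneg = coeffH-nonneg-step 2 6 5 12 12 (≤ᵇ⇒≤ 12 21 _) c₅-nonneg (c-window 6 12 9 _)

H-6-2-6-nonneg : ∀ N → 21 ≤ N → 0ℤ ≤ℤ H 6 2 6 N
H-6-2-6-nonneg N 21≤N =
  subst (λ n → 0ℤ ≤ℤ H 6 2 6 n) (m+[n∸m]≡n 9≤N)
        (subst (0ℤ ≤ℤ_) (sym (H-coeff 6 (N ∸ 9))) (c₆-nonneg (N ∸ 9) (∸-monoˡ-≤ 9 21≤N)))
  where
  9≤N : 9 ≤ N
  9≤N = ≤-trans (≤ᵇ⇒≤ 9 21 _) 21≤N

lemma17 : (N : ℕ) → 67 ≤ N → + 0 ≤ℤ H 6 2 6 N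
lemma17 N 67≤N = H-6-2-6-nonneg N (≤-trans (≤ᵇ⇒≤ 21 67 _) 67≤N)
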